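{- Let $p(x)\in\mathbb{Z}[x]$ be a polynomial of degree $d\ge1$ without constant term, and assume that no prime divides all coefficients of $p$. Let $\mathcal{D}_N=\{p(m)-p(n):1\le m\ne n\le N\}$. Then for every integer $\ell>1$, $$\#\{n\in\mathcal{D}_N:\ell\mid n\}\le\frac{(N+\mathrm{rad}(\ell))^2}{\mathrm{rad}(\ell)}d^{\omega(\ell)}.$$
   Context: $\mathrm{rad}(\ell)$ is the product of the distinct prime factors of $\ell$, and $\omega(\ell)$ is the number of distinct prime factors of $\ell$. -}

module Defs where

open import Data.Nat as ℕ using (ℕ; zero; suc; _≟_)
open import Data.Nat.Divisibility using (_∣?_)
open import Data.Nat.Primality using (prime?)
open import Data.Integer as ℤ using (ℤ; +_; ∣_∣)
open import Data.List using (List; []; _∷_; filter; deduplicate; length; upTo; concatMap; map)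
open import Data.Nat.ListAction using (product)
open import Relation.Nullary.Decidable using (_×-dec_; ¬?)

-- A polynomial of degree ≤ d is given by its coefficient function a : ℕ → ℤ
-- (coefficient of x^i is a i, for i ≤ d).  evalPoly a d x = Σ_{i=0}^{d} a i * x^i.
evalPoly : (ℕ → ℤ) → ℕ → ℤ → ℤ
evalPoly a zero    x = a zero
evalPoly a (suc d) x = evalPoly a d x ℤ.+ a (suc d) ℤ.* (x ℤ.^ suc d)

range1 : ℕ → List ℕ
range1 N = map suc (upTo N)

diffList : (ℕ → ℤ) → ℕ → ℕ → List ℤ
diffList a d N =
  concatMap (λ m → map (λ n → evalPoly a d (+ m) ℤ.- evalPoly a d (+ n))
                       (filter (λ n → ¬? (m ≟ n)) (range1 N)))
            (range1 N)

DN : (ℕ → ℤ) → ℕ → ℕ → List ℤ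
DN a d N = deduplicate ℤ._≟_ (diffList a d N)

countDiv : (ℕ → ℤ) → ℕ → ℕ → ℕ → ℕ
countDiv a d N ℓ = length (filter (λ n → ℓ ∣? ∣ n ∣) (DN a d N))

primeDivisors : ℕ → List ℕ
primeDivisors ℓ = filter (λ q → prime? q ×-dec (q ∣? ℓ)) (upTo (suc ℓ))

rad : ℕ → ℕ
rad ℓ = product (primeDivisors ℓ)

ω : ℕ → ℕ
ω ℓ = length (primeDivisors ℓ)

{-# OPTIONS --safe #-}
module Submission where

-- Fix m ≤ N. Every q ∣ ℓ with q prime divides p(n) − p(m) for each n counted against m, and
-- p − p(m) stays nonzero mod q because a₀ = 0 and the coefficients of p have no common prime
-- factor; by Lagrange's theorem the n then fall into at most d residue classes mod q, hence,
-- by the Chinese remainder theorem, into at most d^ω(ℓ) classes mod rad ℓ. A residue class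
-- mod rad ℓ contains at most N / rad ℓ + 1 of the numbers 1, …, N, and summing over the N
-- values of m gives the bound.

module ListCounting where

  open import Data.Nat using (zero; suc; _≤_; _<_; _+_; _*_; z≤n; s≤s; _≟_)
  open import Data.Nat.Properties using (+-suc; +-mono-≤; ≤-pred; ≤∧≢⇒<; module ≤-Reasoning)
  open import Data.List using (List; []; _∷_; _++_; length; filter; map; concatMap; deduplicate)
  open import Data.List.Properties using (filter-++; length-++)
  open import Data.List.Relation.Unary.All as All using (All; []; _∷_)
  open import Data.List.Relation.Unary.All.Properties as All using (all-filter)
  open import Data.List.Relation.Unary.AllPairs using (AllPairs; []; _∷_)
  import Data.List.Relation.Unary.AllPairs.Properties as AllPairs
  open import Data.List.Relation.Binary.Sublist.Propositional
    using (_⊆_; []; _∷_; _∷ʳ_; minimum; ⊆-trans)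
  open import Data.List.Relation.Binary.Sublist.Propositional.Properties
    using (All-resp-⊆; filter-⊆; filter⁺; length-mono-≤)
  open import Data.Bool using (true; false)
  open import Data.Product using (_,_)
  open import Function using (_∘_; id)
  open import Relation.Binary using () renaming (Decidable to Decidable₂)
  open import Relation.Binary.PropositionalEquality
  open import Relation.Nullary using (¬_; yes; no; does; contradiction)
  open import Relation.Unary using () renaming (Decidable to Decidable₁)
  open import Relation.Unary.Properties using (∁?)

  module _ {A : Set} where

    AllPairs-resp-⊆ : ∀ {R : A → A → Set} {xs ys} → ys ⊆ xs → AllPairs R xs → AllPairs R ys
    AllPairs-resp-⊆ []         []       = []
    AllPairs-resp-⊆ (_ ∷ʳ τ)   (_ ∷ ps) = AllPairs-resp-⊆ τ ps
    AllPairs-resp-⊆ (refl ∷ τ) (p ∷ ps) = All-resp-⊆ τ p ∷ AllPairs-resp-⊆ τ ps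

    deduplicate-⊆ : ∀ {R : A → A → Set} (R? : Decidable₂ R) xs → deduplicate R? xs ⊆ xs
    deduplicate-⊆ R? []       = []
    deduplicate-⊆ R? (x ∷ xs) = refl ∷ ⊆-trans (filter-⊆ _ _) (deduplicate-⊆ R? xs)

    module _ {P : A → Set} (P? : Decidable₁ P) where

      length-filter-deduplicate : ∀ {R : A → A → Set} (R? : Decidable₂ R) xs →
                                  length (filter P? (deduplicate R? xs)) ≤ length (filter P? xs)
      length-filter-deduplicate R? xs =
        length-mono-≤ (filter⁺ P? P? (λ { refl → id }) (deduplicate-⊆ R? xs))

      length≡filter+filter-∁ : ∀ xs →
                               length xs ≡ length (filter P? xs) + length (filter (∁? P?) xs)
      length≡filter+filter-∁ []       = refl
      length≡filter+filter-∁ (x ∷ xs) with P? x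
      ... | yes _ = cong suc (length≡filter+filter-∁ xs)
      ... | no  _ = trans (cong suc (length≡filter+filter-∁ xs)) (sym (+-suc _ _))

      length-filter-concatMap : ∀ {B : Set} {n} (f : B → List A) ys →
                                (∀ y → length (filter P? (f y)) ≤ n) →
                                length (filter P? (concatMap f ys)) ≤ length ys * n
      length-filter-concatMap f []       _     = z≤n
      length-filter-concatMap {n = n} f (y ∷ ys) bound = begin
        length (filter P? (f y ++ concatMap f ys))
          ≡⟨ cong length (filter-++ P? (f y) (concatMap f ys)) ⟩
        length (filter P? (f y) ++ filter P? (concatMap f ys))
          ≡⟨ length-++ (filter P? (f y)) ⟩
        length (filter P? (f y)) + length (filter P? (concatMap f ys))
          ≤⟨ +-mono-≤ (bound y) (length-filter-concatMap f ys bound) ⟩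
        n + length ys * n
          ∎
        where open ≤-Reasoning

    length-filter-map : ∀ {B : Set} {P : A → Set} (P? : Decidable₁ P) (f : B → A) ys →
                        length (filter P? (map f ys)) ≡ length (filter (P? ∘ f) ys)
    length-filter-map P? f []       = refl
    length-filter-map P? f (y ∷ ys) with does (P? (f y))
    ... | true  = cong suc (length-filter-map P? f ys)
    ... | false = length-filter-map P? f ys

    module _ {_~_ : A → A → Set} (_~?_ : Decidable₂ _~_)
             (~-euclidean : ∀ {x y z} → x ~ y → x ~ z → y ~ z) where

      All⇒AllPairs : ∀ {x ys} → All (x ~_) ys → AllPairs _~_ ys
      All⇒AllPairs []           = []
      All⇒AllPairs (x~y ∷ x~ys) = All.map (~-euclidean x~y) x~ys ∷ All⇒AllPairs x~ys

      length≤classes*classSize : ∀ c b xs →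
        (∀ {ys} → ys ⊆ xs → AllPairs _~_ ys → length ys ≤ b) →
        (∀ {ys} → ys ⊆ xs → AllPairs (λ x y → ¬ x ~ y) ys → length ys ≤ c) →
        length xs ≤ c * b
      length≤classes*classSize c       b []       _     _           = z≤n
      length≤classes*classSize zero    b (x ∷ xs) _     transversal
        with () ← transversal (refl ∷ minimum xs) ([] ∷ [])
      length≤classes*classSize (suc c) b (x ∷ xs) class transversal = begin
        suc (length xs)
          ≡⟨ cong suc (length≡filter+filter-∁ (x ~?_) xs) ⟩
        suc (length (filter (x ~?_) xs)) + length unrelated
          ≤⟨ +-mono-≤ classOfx unrelatedBound ⟩
        b + c * b
          ∎
        where
        open ≤-Reasoning
        unrelated : List A
        unrelated = filter (∁? (x ~?_)) xs
        classOfx : suc (length (filter (x ~?_) xs)) ≤ b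
        classOfx = class (refl ∷ filter-⊆ _ xs)
                         (all-filter (x ~?_) xs ∷ All⇒AllPairs (all-filter (x ~?_) xs))
        unrelatedBound : length unrelated ≤ c * b
        unrelatedBound = length≤classes*classSize c b unrelated
          (λ τ → class (x ∷ʳ ⊆-trans τ (filter-⊆ _ xs)))
          (λ τ ps → ≤-pred (transversal (refl ∷ ⊆-trans τ (filter-⊆ _ xs))
                                        (All-resp-⊆ τ (all-filter (∁? (x ~?_)) xs) ∷ ps)))

  length≤bound-of-distinct : ∀ n {xs} → AllPairs _≢_ xs → All (_< n) xs → length xs ≤ n
  length≤bound-of-distinct zero    {[]}    _        _        = z≤n
  length≤bound-of-distinct zero    {_ ∷ _} _        (() ∷ _)
  length≤bound-of-distinct (suc n) {xs}    distinct bounded  = begin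
    length xs
      ≡⟨ length≡filter+filter-∁ (_≟ n) xs ⟩
    length (filter (_≟ n) xs) + length (filter (∁? (_≟ n)) xs)
      ≤⟨ +-mono-≤ (atMostOne (AllPairs.filter⁺ _ distinct) (all-filter (_≟ n) xs))
                  (length≤bound-of-distinct n (AllPairs.filter⁺ _ distinct)
                     (All.zipWith (λ (x<1+n , x≢n) → ≤∧≢⇒< (≤-pred x<1+n) x≢n)
                                  (All.filter⁺ _ bounded , all-filter (∁? (_≟ n)) xs))) ⟩
    1 + n
      ∎
    where
    open ≤-Reasoning
    atMostOne : ∀ {ys} → AllPairs _≢_ ys → All (_≡ n) ys → length ys ≤ 1
    atMostOne {[]}        _               _                 = z≤n
    atMostOne {_ ∷ []}    _               _                 = s≤s z≤n
    atMostOne {_ ∷ _ ∷ _} ((x≢y ∷ _) ∷ _) (refl ∷ refl ∷ _) = contradiction refl x≢y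

module Congruence where

  open import Data.Nat as ℕ using (ℕ; suc; _≤_; s≤s; _/_; _%_; NonZero)
  open import Data.Nat.Properties using (≤-total; m+[n∸m]≡n)
  open import Data.Nat.DivMod using (m≡m%n+[m/n]*n; [m+kn]%n≡m%n; /-monoˡ-≤)
  import Data.Nat.Divisibility as ℕ
  open import Data.Nat.Primality using (Prime; euclidsLemma; prime⇒irreducible; ¬prime[1])
  open import Data.Nat.ListAction using (product)
  open import Data.Integer using (ℤ; +_; _-_; 0ℤ)
  open import Data.Integer.Properties using (+-inverseʳ; m-n≡m⊖n; ⊖-≥)
  open import Data.Integer.Divisibility.Signed
    using (_∣_; divides; _∣?_; ∣m∣n⇒∣m-n; ∣⇒∣ᵤ; ∣ᵤ⇒∣)
  open import Data.Integer.Tactic.RingSolver using (solve-∀)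
  open import Data.List using (_∷_; length)
  open import Data.List.Properties using (length-map)
  open import Data.List.Relation.Unary.All as All using (All; []; _∷_)
  import Data.List.Relation.Unary.All.Properties as All
  open import Data.List.Relation.Unary.AllPairs using (AllPairs; []; _∷_)
  import Data.List.Relation.Unary.AllPairs as AllPairs
  import Data.List.Relation.Unary.AllPairs.Properties as AllPairs
  open import Data.Product using (_,_)
  open import Data.Sum using (inj₁; inj₂)
  open import Relation.Binary.PropositionalEquality
  open import Relation.Nullary using (¬_; Dec; contradiction)
  open ListCounting using (length≤bound-of-distinct)

  prime∤product : ∀ {p ps} → Prime p → All Prime ps → All (p ≢_) ps → ¬ p ℕ.∣ product ps
  prime∤product p-prime [] [] p∣1 = ¬prime[1] (subst Prime (ℕ.∣1⇒≡1 p∣1) p-prime)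
  prime∤product {p} {q ∷ qs} p-prime (q-prime ∷ qs-prime) (p≢q ∷ p∉qs) p∣q*qs
    with euclidsLemma q (product qs) p-prime p∣q*qs
  ... | inj₂ p∣qs = prime∤product p-prime qs-prime p∉qs p∣qs
  ... | inj₁ p∣q  with prime⇒irreducible q-prime p∣q
  ...   | inj₁ p≡1 = ¬prime[1] (subst Prime p≡1 p-prime)
  ...   | inj₂ p≡q = p≢q p≡q

  product-∣ : ∀ {ps n} → AllPairs _≢_ ps → All Prime ps → All (ℕ._∣ n) ps →
              product ps ℕ.∣ n
  product-∣ [] [] [] = ℕ.1∣ _
  product-∣ {p ∷ ps} (p∉ps ∷ distinct) (p-prime ∷ ps-prime) (p∣n ∷ ps∣n)
    with ℕ.divides t n≡t*ps ← product-∣ distinct ps-prime ps∣n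
    with euclidsLemma t (product ps) p-prime (subst (p ℕ.∣_) n≡t*ps p∣n)
  ... | inj₁ p∣t  =
    subst (p ℕ.* product ps ℕ.∣_) (sym n≡t*ps) (ℕ.*-monoˡ-∣ (product ps) p∣t)
  ... | inj₂ p∣ps = contradiction p∣ps (prime∤product p-prime ps-prime p∉ps)

  infix 4 _≡_mod_ _≡?_mod_

  _≡_mod_ : ℤ → ℤ → ℕ → Set
  x ≡ y mod m = + m ∣ x - y

  _≡?_mod_ : ∀ x y m → Dec (x ≡ y mod m)
  x ≡? y mod m = + m ∣? x - y

  ≡-mod-refl : ∀ {x m} → x ≡ x mod m
  ≡-mod-refl {x} = divides 0ℤ (+-inverseʳ x)

  ≡-mod-euclidean : ∀ {x y z m} → x ≡ y mod m → x ≡ z mod m → y ≡ z mod m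
  ≡-mod-euclidean {x} {y} {z} {m} x≡y x≡z =
    subst (+ m ∣_) (difference x y z) (∣m∣n⇒∣m-n x≡z x≡y)
    where
    difference : ∀ x y z → (x - z) - (x - y) ≡ y - z
    difference = solve-∀

  ≡-mod-sym : ∀ {x y m} → x ≡ y mod m → y ≡ x mod m
  ≡-mod-sym {x} {y} {m} x≡y = ≡-mod-euclidean {x} {y} {x} {m} x≡y (≡-mod-refl {x} {m})

  ≡-mod-product : ∀ {x y ps} → AllPairs _≢_ ps → All Prime ps →
                  All (x ≡ y mod_) ps → x ≡ y mod product ps
  ≡-mod-product distinct ps-prime congruent =
    ∣ᵤ⇒∣ (product-∣ distinct ps-prime (All.map ∣⇒∣ᵤ congruent))

  module _ (r : ℕ) .{{_ : NonZero r}} where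

    ≤∧≡-mod⇒%≡ : ∀ {x y} → y ≤ x → + x ≡ + y mod r → x % r ≡ y % r
    ≤∧≡-mod⇒%≡ {x} {y} y≤x x≡y
      with ℕ.divides k x∸y≡k*r ← ∣⇒∣ᵤ (subst (+ r ∣_) (trans (m-n≡m⊖n x y) (⊖-≥ y≤x)) x≡y)
      = begin
      x % r                   ≡⟨ cong (_% r) (m+[n∸m]≡n y≤x) ⟨
      (y ℕ.+ (x ℕ.∸ y)) % r   ≡⟨ cong (λ t → (y ℕ.+ t) % r) x∸y≡k*r ⟩
      (y ℕ.+ k ℕ.* r) % r     ≡⟨ [m+kn]%n≡m%n y k r ⟩
      y % r                   ∎
      where open ≡-Reasoning

    ≡-mod⇒%≡ : ∀ {x y} → + x ≡ + y mod r → x % r ≡ y % r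
    ≡-mod⇒%≡ {x} {y} x≡y with ≤-total y x
    ... | inj₁ y≤x = ≤∧≡-mod⇒%≡ y≤x x≡y
    ... | inj₂ x≤y = sym (≤∧≡-mod⇒%≡ x≤y (≡-mod-sym {+ x} {+ y} {r} x≡y))

    /∧%-injective : ∀ {x y} → x / r ≡ y / r → x % r ≡ y % r → x ≡ y
    /∧%-injective {x} {y} x/r≡y/r x%r≡y%r = begin
      x                       ≡⟨ m≡m%n+[m/n]*n x r ⟩
      x % r ℕ.+ x / r ℕ.* r   ≡⟨ cong₂ (λ s t → s ℕ.+ t ℕ.* r) x%r≡y%r x/r≡y/r ⟩
      y % r ℕ.+ y / r ℕ.* r   ≡⟨ m≡m%n+[m/n]*n y r ⟨
      y                       ∎
      where open ≡-Reasoning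

    length-congruent-class≤ : ∀ n {xs} → AllPairs _≢_ xs →
                              AllPairs (λ x y → + x ≡ + y mod r) xs →
                              All (_≤ n) xs → length xs ≤ suc (n / r)
    length-congruent-class≤ n {xs} distinct congruent bounded =
      subst (_≤ suc (n / r)) (length-map (_/ r) xs)
        (length≤bound-of-distinct (suc (n / r))
          (AllPairs.map⁺ (AllPairs.zipWith
             (λ (x≢y , x≡y) x/r≡y/r → x≢y (/∧%-injective x/r≡y/r (≡-mod⇒%≡ x≡y)))
             (distinct , congruent)))
          (All.map⁺ (All.map (λ x≤n → s≤s (/-monoˡ-≤ r x≤n)) bounded)))

module IntegerPolynomial where

  open import Defs using (evalPoly)
  open import Data.Nat as ℕ using (ℕ; zero; suc; _≤_; _<_; z≤n; s≤s)
  open import Data.Nat.Properties using (≤-pred)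
  import Data.Nat.Divisibility as ℕ
  open import Data.Nat.Primality using (Prime; euclidsLemma)
  open import Data.Integer using (ℤ; +_; _+_; _*_; _-_; _^_; 0ℤ)
  open import Data.Integer.Properties using (abs-*; *-zeroʳ; +-identityʳ)
  open import Data.Integer.Divisibility using () renaming (_∣_ to _∣ᵤ_)
  open import Data.Integer.Divisibility.Signed
    using (_∣_; ∣m∣n⇒∣m-n; ∣m+n∣n⇒∣m; ∣n⇒∣m*n; ∣⇒∣ᵤ; ∣ᵤ⇒∣)
  open import Data.Integer.Tactic.RingSolver using (solve-∀)
  open import Data.List using (List; []; _∷_; length)
  open import Data.List.Membership.Propositional using (_∈_)
  open import Data.List.Relation.Unary.Any using (here; there)
  open import Data.List.Relation.Unary.All as All using (All; []; _∷_)
  open import Data.List.Relation.Unary.AllPairs using (AllPairs; _∷_)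
  import Data.List.Relation.Unary.AllPairs as AllPairs
  open import Data.List.Relation.Binary.Sublist.Propositional.Properties using (All-resp-⊆)
  open import Data.Product using (∃-syntax; _×_; _,_)
  open import Data.Sum using (_⊎_; inj₁; inj₂)
  open import Function using (_∘_)
  open import Relation.Binary.PropositionalEquality
  open import Relation.Nullary using (¬_; contradiction)
  open ListCounting using (AllPairs-resp-⊆; length≤classes*classSize)
  open Congruence using (_≡_mod_; _≡?_mod_; ≡-mod-euclidean)

  horner : List ℤ → ℤ → ℤ
  horner []       x = 0ℤ
  horner (c ∷ cs) x = c + x * horner cs x

  deflate : ℤ → List ℤ → List ℤ
  deflate x₀ []            = []
  deflate x₀ (c ∷ [])      = []
  deflate x₀ (c ∷ c′ ∷ cs) = horner (c′ ∷ cs) x₀ ∷ deflate x₀ (c′ ∷ cs)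

  length-deflate : ∀ x₀ c cs → length (deflate x₀ (c ∷ cs)) ≡ length cs
  length-deflate x₀ c []        = refl
  length-deflate x₀ c (c′ ∷ cs) = cong suc (length-deflate x₀ c′ cs)

  horner-deflate : ∀ x y cs → horner cs x - horner cs y ≡ (x - y) * horner (deflate x cs) y
  horner-deflate x y []            = sym (*-zeroʳ (x - y))
  horner-deflate x y (c ∷ [])      = constant c x y
    where
    constant : ∀ c x y → (c + x * 0ℤ) - (c + y * 0ℤ) ≡ (x - y) * 0ℤ
    constant = solve-∀
  horner-deflate x y (c ∷ c′ ∷ cs) = begin
    (c + x * h x) - (c + y * h y)
      ≡⟨ split c x y (h x) (h y) ⟩
    (x - y) * h x + y * (h x - h y)
      ≡⟨ cong (λ t → (x - y) * h x + y * t) (horner-deflate x y (c′ ∷ cs)) ⟩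
    (x - y) * h x + y * ((x - y) * q)
      ≡⟨ collect x y (h x) q ⟩
    (x - y) * (h x + y * q)
      ∎
    where
    open ≡-Reasoning
    h : ℤ → ℤ
    h = horner (c′ ∷ cs)
    q : ℤ
    q = horner (deflate x (c′ ∷ cs)) y
    split : ∀ c x y a b → (c + x * a) - (c + y * b) ≡ (x - y) * a + y * (a - b)
    split = solve-∀
    collect : ∀ x y a q → (x - y) * a + y * ((x - y) * q) ≡ (x - y) * (a + y * q)
    collect = solve-∀

  All∣-deflate⇒All∣ : ∀ {k x₀} cs → k ∣ horner cs x₀ → All (k ∣_) (deflate x₀ cs) →
                      All (k ∣_) cs
  All∣-deflate⇒All∣ []            _      _          = []
  All∣-deflate⇒All∣ {k} {x₀} (c ∷ []) k∣c+x₀*0 _    =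
    subst (k ∣_) (trans (cong (λ t → c + t) (*-zeroʳ x₀)) (+-identityʳ c)) k∣c+x₀*0 ∷ []
  All∣-deflate⇒All∣ {k} {x₀} (c ∷ c′ ∷ cs) k∣value (k∣h ∷ k∣rest) =
    ∣m+n∣n⇒∣m k∣value (∣n⇒∣m*n x₀ k∣h) ∷ All∣-deflate⇒All∣ (c′ ∷ cs) k∣h k∣rest

  prime-∣-* : ∀ {q} → Prime q → ∀ x y → + q ∣ x * y → + q ∣ x ⊎ + q ∣ y
  prime-∣-* {q} q-prime x y q∣xy
    with euclidsLemma _ _ q-prime (subst (q ℕ.∣_) (abs-* x y) (∣⇒∣ᵤ q∣xy))
  ... | inj₁ q∣x = inj₁ (∣ᵤ⇒∣ q∣x)
  ... | inj₂ q∣y = inj₂ (∣ᵤ⇒∣ q∣y)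

  module _ {q} (q-prime : Prime q) where

    root-deflate : ∀ cs {x y} → + q ∣ horner cs x → + q ∣ horner cs y → ¬ x ≡ y mod q →
                   + q ∣ horner (deflate x cs) y
    root-deflate cs {x} {y} root-x root-y x≢y
      with prime-∣-* q-prime (x - y) _
             (subst (+ q ∣_) (horner-deflate x y cs) (∣m∣n⇒∣m-n root-x root-y))
    ... | inj₁ x≡y  = contradiction x≡y x≢y
    ... | inj₂ root = root

    length-roots-mod-prime< : ∀ cs → ¬ All (+ q ∣_) cs → ∀ {xs} →
                              All (λ x → + q ∣ horner cs x) xs →
                              AllPairs (λ x y → ¬ x ≡ y mod q) xs →
                              length xs < length cs
    length-roots-mod-prime< []       nonzero _ _ = contradiction [] nonzero
    length-roots-mod-prime< (c ∷ cs) nonzero {[]}     _              _                  = s≤s z≤n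
    length-roots-mod-prime< (c ∷ cs) nonzero {x ∷ xs} (root ∷ roots) (x≢xs ∷ distinct) =
      s≤s (subst (length xs <_) (length-deflate x c cs)
            (length-roots-mod-prime< (deflate x (c ∷ cs))
               (nonzero ∘ All∣-deflate⇒All∣ (c ∷ cs) root)
               (All.zipWith (λ (root-y , x≢y) → root-deflate (c ∷ cs) root root-y x≢y)
                            (roots , x≢xs))
               distinct))

  -- Group the roots by their residue mod q: Lagrange bounds the number of classes by d,
  -- and induction on qs bounds the size of each class.
  length-roots-mod-primes≤ : ∀ {d} cs → length cs ≡ suc d → ∀ {qs} → All Prime qs →
                             All (λ q → ¬ All (+ q ∣_) cs) qs → ∀ {xs} →
                             All (λ x → All (λ q → + q ∣ horner cs x) qs) xs →
                             AllPairs (λ x y → ¬ All (x ≡ y mod_) qs) xs →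
                             length xs ≤ d ℕ.^ length qs
  length-roots-mod-primes≤ cs _ {[]} _ _ {[]}        _ _               = z≤n
  length-roots-mod-primes≤ cs _ {[]} _ _ {_ ∷ []}    _ _               = s≤s z≤n
  length-roots-mod-primes≤ cs _ {[]} _ _ {_ ∷ _ ∷ _} _ ((x≢y ∷ _) ∷ _) = contradiction [] x≢y
  length-roots-mod-primes≤ {d} cs length-cs {q ∷ qs} (q-prime ∷ qs-prime) (nonzero ∷ nonzeros)
                           {xs} roots distinct =
    length≤classes*classSize (λ x y → x ≡? y mod q)
      (λ {x} {y} {z} → ≡-mod-euclidean {x} {y} {z} {q}) d (d ℕ.^ length qs) xs
      (λ τ congruent → length-roots-mod-primes≤ cs length-cs qs-prime nonzeros
         (All.map All.tail (All-resp-⊆ τ roots))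
         (AllPairs.zipWith (λ (x≢y , x≡y) → x≢y ∘ (x≡y ∷_))
                           (AllPairs-resp-⊆ τ distinct , congruent)))
      (λ τ incongruent → ≤-pred (subst (_ <_) length-cs
         (length-roots-mod-prime< q-prime cs nonzero
            (All.map All.head (All-resp-⊆ τ roots)) incongruent)))

  coefficients : (ℕ → ℤ) → ℕ → List ℤ
  coefficients a zero    = a 0 ∷ []
  coefficients a (suc d) = a 0 ∷ coefficients (a ∘ suc) d

  length-coefficients : ∀ a d → length (coefficients a d) ≡ suc d
  length-coefficients a zero    = refl
  length-coefficients a (suc d) = cong suc (length-coefficients (a ∘ suc) d)

  ∈-coefficients : ∀ a {d i} → i ≤ d → a i ∈ coefficients a d
  ∈-coefficients a {zero}  {zero}  _         = here refl
  ∈-coefficients a {suc d} {zero}  _         = here refl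
  ∈-coefficients a {suc d} {suc i} (s≤s i≤d) = there (∈-coefficients (a ∘ suc) i≤d)

  evalPoly-suc : ∀ a d x → evalPoly a (suc d) x ≡ a 0 + x * evalPoly (a ∘ suc) d x
  evalPoly-suc a zero    x = linear (a 0) (a 1) x
    where
    linear : ∀ a₀ a₁ x → a₀ + a₁ * (x * + 1) ≡ a₀ + x * a₁
    linear = solve-∀
  evalPoly-suc a (suc d) x = begin
    evalPoly a (suc d) x + c * (x * x ^ suc d)
      ≡⟨ cong (_+ c * (x * x ^ suc d)) (evalPoly-suc a d x) ⟩
    (a 0 + x * evalPoly (a ∘ suc) d x) + c * (x * x ^ suc d)
      ≡⟨ factor (a 0) x _ c (x ^ suc d) ⟩
    a 0 + x * (evalPoly (a ∘ suc) d x + c * x ^ suc d)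
      ∎
    where
    open ≡-Reasoning
    c : ℤ
    c = a (suc (suc d))
    factor : ∀ a₀ x e c y → (a₀ + x * e) + c * (x * y) ≡ a₀ + x * (e + c * y)
    factor = solve-∀

  horner-coefficients : ∀ a d x → horner (coefficients a d) x ≡ evalPoly a d x
  horner-coefficients a zero    x = trans (cong (λ t → a 0 + t) (*-zeroʳ x)) (+-identityʳ (a 0))
  horner-coefficients a (suc d) x =
    trans (cong (λ t → a 0 + x * t) (horner-coefficients (a ∘ suc) d x)) (sym (evalPoly-suc a d x))

  minusConstant : (ℕ → ℤ) → ℤ → ℕ → ℤ
  minusConstant a c zero    = a 0 - c
  minusConstant a c (suc i) = a (suc i)

  evalPoly-minusConstant : ∀ a c d x → evalPoly (minusConstant a c) d x ≡ evalPoly a d x - c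
  evalPoly-minusConstant a c zero    x = refl
  evalPoly-minusConstant a c (suc d) x =
    trans (cong (_+ a (suc d) * x ^ suc d) (evalPoly-minusConstant a c d x))
          (swap (evalPoly a d x) c (a (suc d) * x ^ suc d))
    where
    swap : ∀ e c t → (e - c) + t ≡ (e + t) - c
    swap = solve-∀

  horner-minusConstant : ∀ a c d x →
                         horner (coefficients (minusConstant a c) d) x ≡ evalPoly a d x - c
  horner-minusConstant a c d x =
    trans (horner-coefficients (minusConstant a c) d x) (evalPoly-minusConstant a c d x)

  minusConstant-nonvanishing : ∀ a c q {d} → a 0 ≡ 0ℤ → ∃[ i ] (i ≤ d × ¬ (+ q) ∣ᵤ a i) →
                               ¬ All (+ q ∣_) (coefficients (minusConstant a c) d)
  minusConstant-nonvanishing a c q a₀≡0 (zero  , _   , q∤a₀) _    =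
    q∤a₀ (subst (+ q ∣ᵤ_) (sym a₀≡0) (q ℕ.∣0))
  minusConstant-nonvanishing a c q a₀≡0 (suc i , i≤d , q∤aᵢ) q∣cs =
    q∤aᵢ (∣⇒∣ᵤ (All.lookup q∣cs (∈-coefficients (minusConstant a c) i≤d)))

open import Defs
open import Data.Nat using (ℕ; suc; _≤_; _<_; _*_; _+_; _^_; _/_; NonZero; _≟_)
open import Data.Nat.Primality using (Prime)
open import Data.Integer using (ℤ; +_; ∣_∣)
open import Data.Integer.Divisibility using (_∣_)
open import Data.Product using (∃-syntax; _×_)
open import Relation.Nullary using (¬_)
open import Relation.Binary.PropositionalEquality using (_≡_; _≢_)

open import Data.Nat.Properties
  using ( *-monoˡ-≤; *-mono-≤; +-monoʳ-≤; m≤m+n; +-comm; *-identityʳ; suc-injective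
        ; module ≤-Reasoning)
open import Data.Nat.DivMod using (m/n*n≤m)
import Data.Nat.Divisibility as ℕ
open import Data.Nat.Primality using (prime?; productOfPrimes≢0)
open import Data.Nat.Tactic.RingSolver using (solve-∀)
import Data.Integer as ℤ
import Data.Integer.Divisibility.Signed as Signed
import Data.Integer.Tactic.RingSolver as ℤ-Solver
open import Data.List using (List; filter; map; upTo; length)
open import Data.List.Properties using (length-map; length-upTo)
open import Data.List.Relation.Unary.All as All using (All)
import Data.List.Relation.Unary.All.Properties as All
open import Data.List.Relation.Unary.AllPairs using (AllPairs)
import Data.List.Relation.Unary.AllPairs as AllPairs
import Data.List.Relation.Unary.AllPairs.Properties as AllPairs
import Data.List.Relation.Unary.Unique.Propositional.Properties as Unique
open import Data.List.Relation.Binary.Sublist.Propositional using (_⊆_; ⊆-trans)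
open import Data.List.Relation.Binary.Sublist.Propositional.Properties using (All-resp-⊆; filter-⊆)
open import Data.Product using (_,_; proj₁)
open import Function using (_∘_)
open import Relation.Binary.PropositionalEquality using (sym; trans; cong; subst)
open import Relation.Nullary using (Dec)
open import Relation.Nullary.Decidable using (¬?; _×-dec_)
open ListCounting
open Congruence
open IntegerPolynomial

length-range1 : ∀ N → length (range1 N) ≡ N
length-range1 N = trans (length-map suc (upTo N)) (length-upTo N)

range1-distinct : ∀ N → AllPairs _≢_ (range1 N)
range1-distinct N = Unique.map⁺ suc-injective (Unique.upTo⁺ N)

range1-bounded : ∀ N → All (_≤ N) (range1 N)
range1-bounded N = All.map⁺ (All.all-upTo N)

primeDivisors-prime×∣ : ∀ ℓ → All (λ q → Prime q × q ℕ.∣ ℓ) (primeDivisors ℓ)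
primeDivisors-prime×∣ ℓ = All.all-filter (λ q → prime? q ×-dec (q ℕ.∣? ℓ)) (upTo (suc ℓ))

primeDivisors-prime : ∀ ℓ → All Prime (primeDivisors ℓ)
primeDivisors-prime ℓ = All.map proj₁ (primeDivisors-prime×∣ ℓ)

primeDivisors-distinct : ∀ ℓ → AllPairs _≢_ (primeDivisors ℓ)
primeDivisors-distinct ℓ =
  AllPairs.filter⁺ (λ q → prime? q ×-dec (q ℕ.∣? ℓ)) (Unique.upTo⁺ (suc ℓ))

rad≢0 : ∀ ℓ → NonZero (rad ℓ)
rad≢0 ℓ = productOfPrimes≢0 (primeDivisors-prime ℓ)

m*[k*[1+m/n]]*n≤[m+n]^2*k : ∀ m n k .{{_ : NonZero n}} →
                            m * (k * suc (m / n)) * n ≤ (m + n) ^ 2 * k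
m*[k*[1+m/n]]*n≤[m+n]^2*k m n k = begin
  m * (k * suc (m / n)) * n
    ≡⟨ rearrange m k (suc (m / n)) n ⟩
  m * (suc (m / n) * n) * k
    ≤⟨ *-monoˡ-≤ k (*-mono-≤ (m≤m+n m n) (+-monoʳ-≤ n (m/n*n≤m m n))) ⟩
  (m + n) * (n + m) * k
    ≡⟨ cong (λ t → (m + n) * t * k) (+-comm n m) ⟩
  (m + n) * (m + n) * k
    ≡⟨ cong (λ t → (m + n) * t * k) (*-identityʳ (m + n)) ⟨
  (m + n) ^ 2 * k
    ∎
  where
  open ≤-Reasoning
  rearrange : ∀ m k s n → m * (k * s) * n ≡ m * (s * n) * k
  rearrange = solve-∀

module _ (a : ℕ → ℤ) (d : ℕ) (a₀≡0 : a 0 ≡ + 0)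
         (noCommonPrime : ∀ (q : ℕ) → Prime q → ∃[ i ] (i ≤ d × ¬ ((+ q) ∣ a i)))
         (N ℓ : ℕ) where

  private
    p : ℕ → ℤ
    p n = evalPoly a d (+ n)

    r : ℕ
    r = rad ℓ

    instance
      r≢0 : NonZero r
      r≢0 = rad≢0 ℓ

    ℓ∣∣_∣? : ∀ v → Dec (ℓ ℕ.∣ ∣ v ∣)
    ℓ∣∣ v ∣? = ℓ ℕ.∣? ∣ v ∣

    range1-except : ℕ → List ℕ
    range1-except m = filter (λ n → ¬? (m ≟ n)) (range1 N)

    divisibleDifferences : ℕ → List ℕ
    divisibleDifferences m = filter (ℓ∣∣_∣? ∘ λ n → p m ℤ.- p n) (range1-except m)

  length-divisibleDifferences≤ : ∀ m → length (divisibleDifferences m) ≤ d ^ ω ℓ * suc (N / r)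
  length-divisibleDifferences≤ m =
    length≤classes*classSize (λ x y → + x ≡? + y mod r)
      (λ {x} {y} {z} → ≡-mod-euclidean {+ x} {+ y} {+ z} {r}) (d ^ ω ℓ) (suc (N / r)) ns
      (λ τ congruent → length-congruent-class≤ r N
         (AllPairs-resp-⊆ (⊆-trans τ ns⊆range1) (range1-distinct N)) congruent
         (All-resp-⊆ (⊆-trans τ ns⊆range1) (range1-bounded N)))
      (λ {zs} τ incongruent → subst (_≤ d ^ ω ℓ) (length-map +_ zs)
         (length-roots-mod-primes≤ cs (length-coefficients _ d) (primeDivisors-prime ℓ)
            (All.map (λ {q} q-prime →
                        minusConstant-nonvanishing a (p m) q a₀≡0 (noCommonPrime q q-prime))
                     (primeDivisors-prime ℓ))
            (All.map⁺ (All-resp-⊆ τ (All.map roots (All.all-filter _ (range1-except m)))))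
            (AllPairs.map⁺ (AllPairs.map
               (λ {x} {y} x≢y → x≢y ∘ ≡-mod-product {+ x} {+ y}
                                          (primeDivisors-distinct ℓ) (primeDivisors-prime ℓ))
               incongruent))))
    where
    ns : List ℕ
    ns = divisibleDifferences m
    ns⊆range1 : ns ⊆ range1 N
    ns⊆range1 = ⊆-trans (filter-⊆ _ _) (filter-⊆ _ _)
    cs : List ℤ
    cs = coefficients (minusConstant a (p m)) d
    negate : ∀ u v → ℤ.- (u ℤ.- v) ≡ v ℤ.- u
    negate = ℤ-Solver.solve-∀
    roots : ∀ {n} → ℓ ℕ.∣ ∣ p m ℤ.- p n ∣ →
            All (λ q → + q Signed.∣ horner cs (+ n)) (primeDivisors ℓ)
    roots {n} ℓ∣pm-pn = All.map
      (λ (_ , q∣ℓ) → subst (_ Signed.∣_)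
         (trans (negate (p m) (p n)) (sym (horner-minusConstant a (p m) d (+ n))))
         (Signed.∣m⇒∣-m (Signed.∣ᵤ⇒∣ (ℕ.∣-trans q∣ℓ ℓ∣pm-pn))))
      (primeDivisors-prime×∣ ℓ)

  countDiv≤ : countDiv a d N ℓ ≤ N * (d ^ ω ℓ * suc (N / r))
  countDiv≤ = begin
    countDiv a d N ℓ
      ≤⟨ length-filter-deduplicate ℓ∣∣_∣? ℤ._≟_ (diffList a d N) ⟩
    length (filter ℓ∣∣_∣? (diffList a d N))
      ≤⟨ length-filter-concatMap ℓ∣∣_∣? _ (range1 N) differencesFrom≤ ⟩
    length (range1 N) * (d ^ ω ℓ * suc (N / r))
      ≡⟨ cong (_* (d ^ ω ℓ * suc (N / r))) (length-range1 N) ⟩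
    N * (d ^ ω ℓ * suc (N / r))
      ∎
    where
    open ≤-Reasoning
    differencesFrom≤ : ∀ m → length (filter ℓ∣∣_∣? (map (λ n → p m ℤ.- p n) (range1-except m)))
                             ≤ d ^ ω ℓ * suc (N / r)
    differencesFrom≤ m = subst (_≤ d ^ ω ℓ * suc (N / r))
      (sym (length-filter-map ℓ∣∣_∣? (λ n → p m ℤ.- p n) (range1-except m)))
      (length-divisibleDifferences≤ m)

lemma10 : (a : ℕ → ℤ) (d : ℕ) → 1 ≤ d → a d ≢ + 0 → a 0 ≡ + 0 →
    (∀ (q : ℕ) → Prime q → ∃[ i ] (i ≤ d × ¬ ((+ q) ∣ a i))) →
    (N ℓ : ℕ) → 1 < ℓ →
    countDiv a d N ℓ * rad ℓ ≤ (N + rad ℓ) ^ 2 * d ^ ω ℓ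
lemma10 a d _ _ a₀≡0 noCommonPrime N ℓ _ = begin
  countDiv a d N ℓ * rad ℓ
    ≤⟨ *-monoˡ-≤ (rad ℓ) (countDiv≤ a d a₀≡0 noCommonPrime N ℓ) ⟩
  N * (d ^ ω ℓ * suc (N / rad ℓ)) * rad ℓ
    ≤⟨ m*[k*[1+m/n]]*n≤[m+n]^2*k N (rad ℓ) (d ^ ω ℓ) ⟩
  (N + rad ℓ) ^ 2 * d ^ ω ℓ
    ∎
  where
  open ≤-Reasoning
  instance
    rad[ℓ]≢0 : NonZero (rad ℓ)
    rad[ℓ]≢0 = rad≢0 ℓ
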